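{- Let $n\geq 3$, $Y\cong\mathbb{Z}_4\times(\mathbb{Z}_2)^{n-2}$, let $W\cong(\mathbb{Z}_2)^3$ be a subgroup of $Y$, and let $R$ be a subset of $Y$ of cardinality $5$ with $\sum_{r\in R}r=0$, such that $W\cap\langle R\rangle=\{0\}$, where $\langle R\rangle$ is the subgroup generated by $R$. Then the set $W+R=\{w+r\colon w\in W,\,r\in R\}$ contains $8$ pairwise disjoint subsets, each of cardinality $5$ and each with sum $0$.
   Context: Groups are written additively. -}

module Defs where

open import Data.Nat using (ℕ; zero; suc; _∸_; _≤_)
import Data.Nat as N
open import Data.Nat.DivMod using (_mod_)
open import Data.Fin using (Fin; toℕ; fromℕ)
import Data.Fin as F
open import Data.Vec using (Vec; zipWith; replicate; map)
open import Data.Product using (_×_; _,_; Σ; ∃)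
open import Relation.Binary.PropositionalEquality using (_≡_)


addZ : ∀ {k} → Fin (suc k) → Fin (suc k) → Fin (suc k)
addZ {k} a b = (toℕ a N.+ toℕ b) mod (suc k)

negZ : ∀ {k} → Fin (suc k) → Fin (suc k)
negZ {k} a = (suc k ∸ toℕ a) mod (suc k)

Z2 : Set
Z2 = Fin 2

Z4 : Set
Z4 = Fin 4

-- Y m = ℤ₄ × (ℤ₂)^m   (the paper's Y with m = n - 2)
Y : ℕ → Set
Y m = Z4 × Vec Z2 m

0Y : ∀ {m} → Y m
0Y = F.zero , replicate _ F.zero

_+Y_ : ∀ {m} → Y m → Y m → Y m
(a , u) +Y (b , v) = addZ a b , zipWith addZ u v

-Y_ : ∀ {m} → Y m → Y m
-Y (a , u) = negZ a , map negZ u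

E3 : Set
E3 = Vec Z2 3

_+E_ : E3 → E3 → E3
u +E v = zipWith addZ u v

sumY : ∀ {m k} → (Fin k → Y m) → Y m
sumY {k = zero} f = 0Y
sumY {k = suc k} f = f F.zero +Y sumY (λ i → f (F.suc i))

-- injective family = a subset of the given cardinality
Injective : ∀ {k} {A : Set} → (Fin k → A) → Set
Injective f = ∀ i j → f i ≡ f j → i ≡ j

data InSpan {m k} (R : Fin k → Y m) : Y m → Set where
  span-0   : InSpan R 0Y
  span-gen : ∀ i → InSpan R (R i)
  span-+   : ∀ {x y} → InSpan R x → InSpan R y → InSpan R (x +Y y)
  span-neg : ∀ {x} → InSpan R x → InSpan R (-Y x)

-- φ is an injective group homomorphism (ℤ₂)^3 → Y; its image is W ≅ (ℤ₂)^3
IsEmbedding : ∀ {m} → (E3 → Y m) → Set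
IsEmbedding φ = (∀ u v → φ (u +E v) ≡ φ u +Y φ v) × (∀ u v → φ u ≡ φ v → u ≡ v)

InW : ∀ {m} → (E3 → Y m) → Y m → Set
InW φ x = Σ E3 λ u → φ u ≡ x

InWR : ∀ {m k} → (E3 → Y m) → (Fin k → Y m) → Y m → Set
InWR φ R x = Σ E3 λ u → Σ (Fin _) λ i → x ≡ φ u +Y R i

-- Identify W with 𝔽₈ = 𝔽₂[t]/(t³ + t + 1) through the embedding φ and, for each w ∈ 𝔽₈, take the
-- row {φ(c_k w) + r_k : k < 5} with multipliers (c₀, …, c₄) = (1, 1, 1, t, t³).  Since t³ = 1 + t,
-- the multipliers sum to 0 in 𝔽₈, so every row sums to Σ r_k = 0; since each c_k is a unit, two
-- rows never use the same point of W in the same column.  Finally φ(a) + r = φ(b) + r' forces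
-- a = b and r = r', because φ(a − b) = r' − r lies in W ∩ ⟨R⟩ = 0.  This makes each row a
-- 5-element set and the 8 rows pairwise disjoint.
module Submission where

open import Algebra.Bundles using (AbelianGroup)
open import Algebra.Definitions using (Associative; Commutative; LeftIdentity; RightInverse)
open import Algebra.Structures using (IsAbelianGroup)
import Algebra.Properties.AbelianGroup as AbelianGroupProperties
import Algebra.Properties.CommutativeSemigroup as CommutativeSemigroupProperties
import Algebra.Properties.Monoid.Sum as MonoidSum
open import Data.Fin using (Fin; zero; suc; toℕ; remQuot; combine)
open import Data.Fin.Patterns using (0F; 1F; 2F; 3F; 4F)
open import Data.Fin.Properties using (toℕ-fromℕ<; toℕ-injective; toℕ<n; toℕ≤n; combine-remQuot)
open import Data.Nat using (ℕ; suc; _+_; _^_; _%_; _≤_; _∸_; NonZero)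
open import Data.Nat.DivMod using (_mod_; %-distribˡ-+; m%n%n≡m%n; m<n⇒m%n≡m; n%n≡0)
open import Data.Nat.Properties using (+-comm; +-assoc; m+[n∸m]≡n)
open import Data.Product using (_×_; Σ; _,_; proj₁; proj₂; uncurry)
open import Data.Product.Properties using (×-≡,≡→≡)
open import Data.Vec using (Vec; []; _∷_; zipWith; replicate)
open import Data.Vec.Properties using (∷-injective; zipWith-assoc; zipWith-comm; zipWith-identityˡ; zipWith-inverseʳ)
open import Function using (id; _∘_)
open import Level using (0ℓ)
open import Relation.Binary.PropositionalEquality
open ≡-Reasoning

open import Defs

isAbelianGroupˡ : ∀ {A : Set} {_∙_ : A → A → A} {ε : A} {_⁻¹ : A → A} →
  Associative _≡_ _∙_ → Commutative _≡_ _∙_ → LeftIdentity _≡_ ε _∙_ → RightInverse _≡_ ε _⁻¹ _∙_ →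
  IsAbelianGroup _≡_ _∙_ ε _⁻¹
isAbelianGroupˡ {_∙_ = _∙_} {ε} {_⁻¹} assoc comm identityˡ inverseʳ = record
  { isGroup = record
    { isMonoid = record
      { isSemigroup = record
        { isMagma = record { isEquivalence = isEquivalence ; ∙-cong = cong₂ _∙_ }
        ; assoc = assoc
        }
      ; identity = identityˡ , λ x → trans (comm x ε) (identityˡ x)
      }
    ; inverse = (λ x → trans (comm (x ⁻¹) x) (inverseʳ x)) , inverseʳ
    ; ⁻¹-cong = cong _⁻¹
    }
  ; comm = comm
  }

[m+n%d]%d≡[m+n]%d : ∀ m n d .{{_ : NonZero d}} → (m + n % d) % d ≡ (m + n) % d
[m+n%d]%d≡[m+n]%d m n d = begin
  (m + n % d) % d          ≡⟨ %-distribˡ-+ m (n % d) d ⟩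
  (m % d + n % d % d) % d  ≡⟨ cong (λ x → (m % d + x) % d) (m%n%n≡m%n n d) ⟩
  (m % d + n % d) % d      ≡⟨ %-distribˡ-+ m n d ⟨
  (m + n) % d              ∎

[m%d+n]%d≡[m+n]%d : ∀ m n d .{{_ : NonZero d}} → (m % d + n) % d ≡ (m + n) % d
[m%d+n]%d≡[m+n]%d m n d = begin
  (m % d + n) % d  ≡⟨ cong (_% d) (+-comm (m % d) n) ⟩
  (n + m % d) % d  ≡⟨ [m+n%d]%d≡[m+n]%d n m d ⟩
  (n + m) % d      ≡⟨ cong (_% d) (+-comm n m) ⟩
  (m + n) % d      ∎

module _ {k : ℕ} where

  toℕ-addZ : (a b : Fin (suc k)) → toℕ (addZ a b) ≡ (toℕ a + toℕ b) % suc k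
  toℕ-addZ a b = toℕ-fromℕ< _

  addZ-assoc : Associative _≡_ (addZ {k})
  addZ-assoc a b c = toℕ-injective (begin
    toℕ (addZ (addZ a b) c)                   ≡⟨ toℕ-addZ (addZ a b) c ⟩
    (toℕ (addZ a b) + toℕ c) % suc k          ≡⟨ cong (λ x → (x + toℕ c) % suc k) (toℕ-addZ a b) ⟩
    ((toℕ a + toℕ b) % suc k + toℕ c) % suc k ≡⟨ [m%d+n]%d≡[m+n]%d (toℕ a + toℕ b) (toℕ c) (suc k) ⟩
    (toℕ a + toℕ b + toℕ c) % suc k           ≡⟨ cong (_% suc k) (+-assoc (toℕ a) (toℕ b) (toℕ c)) ⟩
    (toℕ a + (toℕ b + toℕ c)) % suc k         ≡⟨ [m+n%d]%d≡[m+n]%d (toℕ a) (toℕ b + toℕ c) (suc k) ⟨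
    (toℕ a + (toℕ b + toℕ c) % suc k) % suc k ≡⟨ cong (λ x → (toℕ a + x) % suc k) (toℕ-addZ b c) ⟨
    (toℕ a + toℕ (addZ b c)) % suc k          ≡⟨ toℕ-addZ a (addZ b c) ⟨
    toℕ (addZ a (addZ b c))                   ∎)

  addZ-comm : Commutative _≡_ (addZ {k})
  addZ-comm a b = cong (λ x → x mod suc k) (+-comm (toℕ a) (toℕ b))

  addZ-identityˡ : LeftIdentity _≡_ zero (addZ {k})
  addZ-identityˡ a = toℕ-injective (trans (toℕ-addZ zero a) (m<n⇒m%n≡m (toℕ<n a)))

  addZ-inverseʳ : RightInverse _≡_ zero negZ (addZ {k})
  addZ-inverseʳ a = toℕ-injective (begin
    toℕ (addZ a (negZ a))                     ≡⟨ toℕ-addZ a (negZ a) ⟩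
    (toℕ a + toℕ (negZ a)) % suc k            ≡⟨ cong (λ x → (toℕ a + x) % suc k) (toℕ-fromℕ< _) ⟩
    (toℕ a + (suc k ∸ toℕ a) % suc k) % suc k ≡⟨ [m+n%d]%d≡[m+n]%d (toℕ a) (suc k ∸ toℕ a) (suc k) ⟩
    (toℕ a + (suc k ∸ toℕ a)) % suc k         ≡⟨ cong (_% suc k) (m+[n∸m]≡n (toℕ≤n a)) ⟩
    suc k % suc k                             ≡⟨ n%n≡0 (suc k) ⟩
    0                                         ∎)

addZ-self : (a : Z2) → addZ a a ≡ zero
addZ-self zero      = refl
addZ-self (suc zero) = refl

addZ-cancelʳ : (a c : Z2) → addZ (addZ a c) c ≡ a
addZ-cancelʳ a c = begin
  addZ (addZ a c) c  ≡⟨ addZ-assoc a c c ⟩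
  addZ a (addZ c c)  ≡⟨ cong (addZ a) (addZ-self c) ⟩
  addZ a zero        ≡⟨ addZ-comm a zero ⟩
  addZ zero a        ≡⟨ addZ-identityˡ a ⟩
  a                  ∎

Y-abelianGroup : ℕ → AbelianGroup 0ℓ 0ℓ
Y-abelianGroup m = record
  { Carrier = Y m ; _≈_ = _≡_ ; _∙_ = _+Y_ ; ε = 0Y ; _⁻¹ = -Y_
  ; isAbelianGroup = isAbelianGroupˡ
      (λ where (a , u) (b , v) (c , w) → cong₂ _,_ (addZ-assoc a b c) (zipWith-assoc addZ-assoc u v w))
      (λ where (a , u) (b , v) → cong₂ _,_ (addZ-comm a b) (zipWith-comm addZ-comm u v))
      (λ where (a , u) → cong₂ _,_ (addZ-identityˡ a) (zipWith-identityˡ addZ-identityˡ u))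
      (λ where (a , u) → cong₂ _,_ (addZ-inverseʳ a) (zipWith-inverseʳ addZ-inverseʳ u))
  }

-- Every element of (ℤ₂)ⁿ is its own inverse, so the inverse map is taken to be the identity.
Z2ⁿ-abelianGroup : ℕ → AbelianGroup 0ℓ 0ℓ
Z2ⁿ-abelianGroup n = record
  { Carrier = Vec Z2 n ; _≈_ = _≡_ ; _∙_ = zipWith addZ ; ε = replicate n zero ; _⁻¹ = id
  ; isAbelianGroup = isAbelianGroupˡ (zipWith-assoc addZ-assoc) (zipWith-comm addZ-comm)
      (zipWith-identityˡ addZ-identityˡ) zipWith-self
  }
  where
  zipWith-self : ∀ {n} (u : Vec Z2 n) → zipWith addZ u u ≡ replicate n zero
  zipWith-self []      = refl
  zipWith-self (a ∷ u) = cong₂ _∷_ (addZ-self a) (zipWith-self u)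

digits : ∀ b n → Fin (b ^ n) → Vec (Fin b) n
digits b ℕ.zero  _ = []
digits b (suc n) i = proj₁ (remQuot {b} (b ^ n) i) ∷ digits b n (proj₂ (remQuot {b} (b ^ n) i))

digits-injective : ∀ b n {i j : Fin (b ^ n)} → digits b n i ≡ digits b n j → i ≡ j
digits-injective b ℕ.zero {zero} {zero} _ = refl
digits-injective b (suc n) {i} {j} eq with ∷-injective eq
... | same-head , same-tail = begin
  i                                       ≡⟨ combine-remQuot {b} (b ^ n) i ⟨
  uncurry combine (remQuot {b} (b ^ n) i) ≡⟨ cong (uncurry combine) (×-≡,≡→≡ (same-head , digits-injective b n same-tail)) ⟩
  uncurry combine (remQuot {b} (b ^ n) j) ≡⟨ combine-remQuot {b} (b ^ n) j ⟩
  j                                       ∎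

module E3 = AbelianGroup (Z2ⁿ-abelianGroup 3)
open MonoidSum E3.monoid using () renaming (sum to sumE)
open CommutativeSemigroupProperties E3.commutativeSemigroup using (x∙yz≈y∙xz)

-- Multiplication by t in 𝔽₈ = 𝔽₂[t]/(t³ + t + 1), on coefficient vectors (a, b, c) of a + b t + c t².
mul-t : E3 → E3
mul-t (a ∷ b ∷ c ∷ []) = c ∷ addZ a c ∷ b ∷ []

mul-t-injective : ∀ {x y} → mul-t x ≡ mul-t y → x ≡ y
mul-t-injective {x} {y} eq = trans (sym (div-t-mul-t x)) (trans (cong div-t eq) (div-t-mul-t y))
  where
  div-t : E3 → E3
  div-t (p ∷ q ∷ r ∷ []) = addZ q p ∷ r ∷ p ∷ []
  div-t-mul-t : ∀ x → div-t (mul-t x) ≡ x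
  div-t-mul-t (a ∷ b ∷ c ∷ []) = cong (_∷ b ∷ c ∷ []) (addZ-cancelʳ a c)

t³≡1+t : ∀ x → mul-t (mul-t (mul-t x)) ≡ x +E mul-t x
t³≡1+t (a ∷ b ∷ c ∷ []) = refl

column : Fin 5 → E3 → E3
column 0F = id
column 1F = id
column 2F = id
column 3F = mul-t
column 4F = mul-t ∘ mul-t ∘ mul-t

column-injective : ∀ k {x y} → column k x ≡ column k y → x ≡ y
column-injective 0F = id
column-injective 1F = id
column-injective 2F = id
column-injective 3F = mul-t-injective
column-injective 4F = mul-t-injective ∘ mul-t-injective ∘ mul-t-injective

columns-sum : ∀ x → sumE (λ k → column k x) ≡ E3.ε
columns-sum x = begin
  x +E (x +E (x +E (mul-t x +E (t³ +E E3.ε))))        ≡⟨ cong (λ y → x +E (x +E (x +E (mul-t x +E y)))) (trans (E3.identityʳ t³) (t³≡1+t x)) ⟩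
  x +E (x +E (x +E (mul-t x +E (x +E mul-t x))))       ≡⟨ cong (λ y → x +E (x +E (x +E y))) self-cancels ⟩
  x +E (x +E (x +E x))                                 ≡⟨ cong (λ y → x +E (x +E y)) (E3.inverseʳ x) ⟩
  x +E (x +E E3.ε)                                    ≡⟨ cong (x +E_) (E3.identityʳ x) ⟩
  x +E x                                               ≡⟨ E3.inverseʳ x ⟩
  E3.ε                                                ∎
  where
  t³ : E3
  t³ = mul-t (mul-t (mul-t x))
  self-cancels : mul-t x +E (x +E mul-t x) ≡ x
  self-cancels = begin
    mul-t x +E (x +E mul-t x)  ≡⟨ x∙yz≈y∙xz (mul-t x) x (mul-t x) ⟩
    x +E (mul-t x +E mul-t x)  ≡⟨ cong (x +E_) (E3.inverseʳ (mul-t x)) ⟩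
    x +E E3.ε                  ≡⟨ E3.identityʳ x ⟩
    x                          ∎

point : Fin 8 → Fin 5 → E3
point i k = column k (digits 2 3 i)

rows : ∀ {m} → (E3 → Y m) → (Fin 5 → Y m) → Fin 8 → Fin 5 → Y m
rows φ R i k = φ (point i k) +Y R k

module E3-properties = AbelianGroupProperties (Z2ⁿ-abelianGroup 3)

module _ {m : ℕ} where
  open AbelianGroup (Y-abelianGroup m) using (assoc; identityˡ; identityʳ)
  open AbelianGroupProperties (Y-abelianGroup m) using (∙-cancelˡ; x≈z//y)
  open CommutativeSemigroupProperties (AbelianGroup.commutativeSemigroup (Y-abelianGroup m))
    using (interchange; xy∙z≈y∙xz)

  sumY-+ : ∀ {k} (f g : Fin k → Y m) → sumY (λ i → f i +Y g i) ≡ sumY f +Y sumY g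
  sumY-+ {ℕ.zero}  f g = sym (identityˡ 0Y)
  sumY-+ {suc k} f g = trans (cong ((f zero +Y g zero) +Y_) (sumY-+ (f ∘ suc) (g ∘ suc)))
                             (interchange (f zero) (g zero) (sumY (f ∘ suc)) (sumY (g ∘ suc)))

  module Embedding (φ : E3 → Y m) (φ-hom : ∀ u v → φ (u +E v) ≡ φ u +Y φ v) where

    hom-ε : φ E3.ε ≡ 0Y
    hom-ε = ∙-cancelˡ (φ E3.ε) (φ E3.ε) 0Y (begin
      φ E3.ε +Y φ E3.ε  ≡⟨ φ-hom E3.ε E3.ε ⟨
      φ (E3.ε +E E3.ε)  ≡⟨ cong φ (E3.identityˡ E3.ε) ⟩
      φ E3.ε            ≡⟨ identityʳ (φ E3.ε) ⟨
      φ E3.ε +Y 0Y      ∎)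

    hom-self : ∀ u → φ u +Y φ u ≡ 0Y
    hom-self u = trans (sym (φ-hom u u)) (trans (cong φ (E3.inverseʳ u)) hom-ε)

    hom-sum : ∀ {k} (h : Fin k → E3) → sumY (φ ∘ h) ≡ φ (sumE h)
    hom-sum {ℕ.zero}  h = sym hom-ε
    hom-sum {suc k} h = trans (cong (φ (h zero) +Y_) (hom-sum (h ∘ suc))) (sym (φ-hom _ _))

    rows-sum : ∀ R → sumY R ≡ 0Y → ∀ i → sumY (rows φ R i) ≡ 0Y
    rows-sum R R-sum i = begin
      sumY (rows φ R i)                ≡⟨ sumY-+ (φ ∘ point i) R ⟩
      sumY (φ ∘ point i) +Y sumY R     ≡⟨ cong₂ _+Y_ (hom-sum (point i)) R-sum ⟩
      φ (sumE (point i)) +Y 0Y         ≡⟨ cong (λ u → φ u +Y 0Y) (columns-sum (digits 2 3 i)) ⟩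
      φ E3.ε +Y 0Y                     ≡⟨ cong (_+Y 0Y) hom-ε ⟩
      0Y +Y 0Y                         ≡⟨ identityˡ 0Y ⟩
      0Y                               ∎

    module Translates (φ-injective : ∀ u v → φ u ≡ φ v → u ≡ v) {k : ℕ} (R : Fin k → Y m) (R-injective : Injective R)
             (trivial-intersection : ∀ x → InW φ x → InSpan R x → x ≡ 0Y) where

      translate-injective : ∀ a b i j → φ a +Y R i ≡ φ b +Y R j → a ≡ b × i ≡ j
      translate-injective a b i j eq = a≡b , R-injective i j (∙-cancelˡ (φ a) (R i) (R j) eq′)
        where
        difference : φ (a +E b) +Y R i ≡ R j
        difference = begin
          φ (a +E b) +Y R i      ≡⟨ cong (_+Y R i) (φ-hom a b) ⟩
          (φ a +Y φ b) +Y R i    ≡⟨ xy∙z≈y∙xz (φ a) (φ b) (R i) ⟩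
          φ b +Y (φ a +Y R i)    ≡⟨ cong (φ b +Y_) eq ⟩
          φ b +Y (φ b +Y R j)    ≡⟨ assoc (φ b) (φ b) (R j) ⟨
          (φ b +Y φ b) +Y R j    ≡⟨ cong (_+Y R j) (hom-self b) ⟩
          0Y +Y R j              ≡⟨ identityˡ (R j) ⟩
          R j                    ∎
        difference-in-span : InSpan R (φ (a +E b))
        difference-in-span = subst (InSpan R) (sym (x≈z//y _ (R i) (R j) difference))
                                   (span-+ (span-gen j) (span-neg (span-gen i)))
        a≡b : a ≡ b
        a≡b = E3-properties.x∙y⁻¹≈ε⇒x≈y a b
                (φ-injective _ _ (trans (trivial-intersection _ (a +E b , refl) difference-in-span) (sym hom-ε)))
        eq′ : φ a +Y R i ≡ φ a +Y R j
        eq′ = trans eq (cong (λ u → φ u +Y R j) (sym a≡b))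

mainTheorem5 : (n : ℕ) → 3 ≤ n →
    (φ : E3 → Y (n ∸ 2)) → IsEmbedding φ →
    (R : Fin 5 → Y (n ∸ 2)) → Injective R → sumY R ≡ 0Y →
    (∀ x → InW φ x → InSpan R x → x ≡ 0Y) →
    Σ (Fin 8 → Fin 5 → Y (n ∸ 2)) λ S →
      (∀ i → Injective (S i)) ×
      (∀ i j → InWR φ R (S i j)) ×
      (∀ i → sumY (S i) ≡ 0Y) ×
      (∀ i j k l → S i k ≡ S j l → i ≡ j)
mainTheorem5 n _ φ (φ-hom , φ-injective) R R-injective R-sum trivial-intersection =
  rows φ R ,
  (λ i k l → proj₂ ∘ translate-injective (point i k) (point i l) k l) ,
  (λ i k → point i k , k , refl) ,
  rows-sum R R-sum ,
  rows-disjoint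
  where
  open Embedding φ φ-hom
  open Translates φ-injective R R-injective trivial-intersection
  rows-disjoint : ∀ i j k l → rows φ R i k ≡ rows φ R j l → i ≡ j
  rows-disjoint i j k l eq =
    let same-point , same-column = translate-injective (point i k) (point j l) k l eq
    in digits-injective 2 3 (column-injective k (trans same-point (cong (point j) (sym same-column))))
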